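{- Let $\Gamma$ be a finite group that is nilpotent of class $\le n$ (in the sense defined in the context), let $S$ be a generating set of $\Gamma$, let $G=\mathrm{Cay}(\Gamma,S)$, and let $r\ge 2^{n+1}$ be an integer. If $G$ has an $r$-local cutvertex, then $G$ is a cycle of length greater than $r$ and $\Gamma$ is cyclic.
   Context: Generating sets $S$ do not contain the identity $\mathbb{I}$ and are closed under inverses; $\mathrm{Cay}(\Gamma,S)$ is the simple graph with vertex set $\Gamma$ and edges $\{g,gs\}$, $g\in\Gamma$, $s\in S$. $g\equiv h$ means $g=h$ or $g=h^{ -1}$. Nilpotency (paper's definition): with words $[g,h]_1:=gh^{ -1}g^{ -1}h$ and $[g,h]_n:=[g,[g,h]_{n-1}]_1$ (freely reduced), $\Gamma$ is nilpotent of class $\le n$ if $[g,h]_n=\mathbb{I}$ in $\Gamma$ for all $g,h\in\Gamma$ with $g\not\equiv h$. The ball $B_r(v)$ is the subgraph consisting of all vertices and edges lying on closed walks of length at most $r$ through $v$; $v$ is an $r$-local cutvertex if $B_r(v)-v$ is disconnected. -}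

module Defs where

open import Data.Nat using (ℕ; zero; suc; _≤_; _<_)
open import Data.Fin using (Fin; toℕ; fromℕ; inject₁) renaming (zero to fzero; suc to fsuc)
open import Data.Fin.Subset using (Subset; _∈_; _∉_)
open import Data.List using (List; foldr)
open import Data.List.Relation.Unary.All using (All)
open import Data.Product using (Σ; ∃; _×_)
open import Data.Sum using (_⊎_)
open import Relation.Binary.PropositionalEquality using (_≡_; _≢_)
open import Relation.Nullary using (¬_)
open import Algebra.Core using (Op₁; Op₂)
open import Algebra.Structures using (IsGroup)
open import Function.Bundles using (_⤖_; _⇔_; Bijection)

-- Finite groups: a group whose carrier is Fin N (with propositional
-- equality).  Every finite group is isomorphic to one of these.

record FinGroup : Set where
  field
    N       : ℕ
    _∙_     : Op₂ (Fin N)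
    ε       : Fin N
    _⁻¹     : Op₁ (Fin N)
    isGroup : IsGroup _≡_ _∙_ ε _⁻¹
  infixl 7 _∙_
  infix  8 _⁻¹

open FinGroup public

module _ (Γ : FinGroup) where
  private
    V = Fin (N Γ)
    _·_ = _∙_ Γ
    e = ε Γ
    inv = _⁻¹ Γ

  product : List V → V
  product = foldr _·_ e

  record IsGeneratingSet (S : Subset (N Γ)) : Set where
    field
      noIdentity     : e ∉ S
      inverseClosed  : ∀ s → s ∈ S → inv s ∈ S
      generates      : ∀ g → Σ (List V) λ ss → All (_∈ S) ss × product ss ≡ g

  _≡±_ : V → V → Set
  g ≡± h = g ≡ h ⊎ g ≡ inv h

  -- value in Γ of the word [g,h]_k  (k ≥ 1);
  -- [g,h]_1 = g h⁻¹ g⁻¹ h,  [g,h]_{k+1} = [g,[g,h]_k]_1.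
  -- (index 0 is an auxiliary base case: [g,h]_0 := h.)
  comm : ℕ → V → V → V
  comm zero    g h = h
  comm (suc k) g h = ((g · inv c) · inv g) · c
    where c = comm k g h

  NilpotentClassAtMost : ℕ → Set
  NilpotentClassAtMost n = ∀ g h → ¬ (g ≡± h) → comm n g h ≡ e

  pow : V → ℕ → V
  pow g zero    = e
  pow g (suc k) = g · pow g k

  Cyclic : Set
  Cyclic = Σ V λ g → ∀ h → Σ ℕ λ k → pow g k ≡ h

  Cay : Subset (N Γ) → V → V → Set
  Cay S g h = Σ V λ s → s ∈ S × h ≡ g · s

module Graph {N : ℕ} (Adj : Fin N → Fin N → Set) where
  private V = Fin N

  IsWalk : (k : ℕ) → (Fin (suc k) → V) → Set
  IsWalk k w = ∀ (i : Fin k) → Adj (w (inject₁ i)) (w (fsuc i))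

  IsClosedWalk : V → (k : ℕ) → (Fin (suc k) → V) → Set
  IsClosedWalk v k w = IsWalk k w × w fzero ≡ v × w (fromℕ k) ≡ v

  InBall : ℕ → V → V → Set
  InBall r v u = Σ ℕ λ k → k ≤ r × Σ (Fin (suc k) → V) λ w →
                   IsClosedWalk v k w × Σ (Fin (suc k)) λ i → w i ≡ u

  EdgeInBall : ℕ → V → V → V → Set
  EdgeInBall r v a b = Σ ℕ λ k → k ≤ r × Σ (Fin (suc k) → V) λ w →
                   IsClosedWalk v k w × Σ (Fin k) λ i →
                     (w (inject₁ i) ≡ a × w (fsuc i) ≡ b) ⊎
                     (w (inject₁ i) ≡ b × w (fsuc i) ≡ a)

  ConnectedInBallMinus : ℕ → V → V → V → Set
  ConnectedInBallMinus r v x y = Σ ℕ λ k → Σ (Fin (suc k) → V) λ p →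
      p fzero ≡ x × p (fromℕ k) ≡ y ×
      (∀ i → p i ≢ v) ×
      (∀ (i : Fin k) → EdgeInBall r v (p (inject₁ i)) (p (fsuc i)))

  LocalCutvertex : ℕ → V → Set
  LocalCutvertex r v = Σ V λ x → Σ V λ y →
      InBall r v x × x ≢ v × InBall r v y × y ≢ v ×
      ¬ ConnectedInBallMinus r v x y

  CycSucc : (m : ℕ) → Fin m → Fin m → Set
  CycSucc m i j = suc (toℕ i) ≡ toℕ j ⊎ (suc (toℕ i) ≡ m × toℕ j ≡ 0)

  IsCycleOfLength : ℕ → Set
  IsCycleOfLength m = 3 ≤ m × Σ (Fin m ⤖ V) λ f →
      ∀ i j → Adj (Bijection.to f i) (Bijection.to f j) ⇔ (CycSucc m i j ⊎ CycSucc m j i)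

{-# OPTIONS --safe #-}

-- If S contains g and h with g ≢ h^±1, the relator [g,h]_n = 1 spells a closed walk of length
-- 2^(n+1) ≤ r in Cay(Γ,S), and its first repeated vertex cuts out a simple cycle. The word of
-- [g,h]_n is a product of blocks x h⁻¹ y h with x, y ∈ {g, g⁻¹}, so along the cycle the letters
-- alternate between g^±1 and h^±1, and in any four consecutive letters the two h-letters are
-- mutually inverse. Translating the cycle through v shows that v t and v s⁻¹ are joined in
-- B_r(v) − v whenever s t are consecutive letters of the cycle, and these constraints put all of
-- v g^±1, v h^±1 in one component. Doing this for every such pair in S puts every neighbour of v,
-- hence all of B_r(v) − v, in one component. Otherwise S ⊆ {a, a⁻¹}: then Γ = ⟨a⟩ is cyclic of
-- some order m and Cay(Γ,S) is an m-cycle, which for m ≤ r itself joins v a to v a⁻¹ in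
-- B_r(v) − v; so a local cutvertex forces m > r.

module Submission where

open import Defs hiding (_∙_; ε; _⁻¹; _≡±_)
open import Algebra.Bundles using (Group)
import Algebra.Properties.Group as GroupProperties
open import Data.Empty using (⊥-elim)
open import Data.Fin using (Fin; toℕ; fromℕ<; inject₁) renaming (zero to fzero; suc to fsuc)
open import Data.Fin.Properties using (toℕ-fromℕ; toℕ-fromℕ<; toℕ-inject₁; toℕ<n; toℕ-injective; pigeonhole; any?)
  renaming (_≟_ to _≟ᶠ_)
open import Data.Fin.Subset using (Subset; _∈_)
open import Data.Fin.Subset.Properties using (_∈?_)
open import Data.List using (List; []; _∷_; _++_; length; take)
open import Data.List.Properties using (length-++; take-all)
open import Data.List.Relation.Unary.All using (All; []; _∷_)
open import Data.Nat using (ℕ; zero; suc; _≤_; _<_; _^_; _+_; _∸_; _*_; _%_; _/_; z≤n; s≤s; z<s; s<s; NonZero; >-nonZero)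
open import Data.Nat.Divisibility using (_∣_; divides; ∣m+n∣m⇒∣n; n∣m*n; >⇒∤)
open import Data.Nat.DivMod using (m≡m%n+[m/n]*n; [m+kn]%n≡m%n; [m+n]%n≡m%n; m%n<n; m<n⇒m%n≡m; n%n≡0)
open import Data.Nat.Induction using (<-rec)
open import Data.Nat.Properties
open import Data.Product using (Σ; _×_; _,_; proj₁; proj₂)
open import Data.Sum using (_⊎_; inj₁; inj₂)
import Data.Sum
open import Function.Bundles using (_⤖_; _⇔_; mk⤖; mk⇔)
open import Level using (0ℓ)
open import Relation.Binary.Construct.Closure.ReflexiveTransitive using (Star; _◅_; _◅◅_; reverse) renaming (ε to ε⋆)
open import Relation.Binary.PropositionalEquality
open import Relation.Binary.Definitions using (DecidableEquality; tri<; tri≈; tri>)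
open import Relation.Binary.Structures using (IsEquivalence)
open import Relation.Nullary using (¬_; Dec; yes; no)
open import Relation.Nullary.Decidable using (_×-dec_; ¬?; decidable-stable)

module _ {P : ℕ → Set} (P? : ∀ n → Dec (P n)) where

  leastWitness : ∀ n → P n → Σ ℕ λ m → P m × m ≤ n × (∀ k → k < m → ¬ P k)
  leastWitness = <-rec _ search
    where
    search : ∀ n → (∀ {k} → k < n → P k → Σ ℕ λ m → P m × m ≤ k × (∀ j → j < m → ¬ P j)) →
             P n → Σ ℕ λ m → P m × m ≤ n × (∀ j → j < m → ¬ P j)
    search n smaller pn with anyUpTo? P? n
    ... | no none = n , pn , ≤-refl , λ k k<n pk → none (k , k<n , pk)
    ... | yes (k , k<n , pk) with smaller k<n pk
    ...   | m , pm , m≤k , least = m , pm , ≤-trans m≤k (<⇒≤ k<n) , least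

record FirstRepetition {A : Set} (p : ℕ → A) (J : ℕ) : Set where
  field
    start period : ℕ
    period>0     : 0 < period
    bounded      : start + period ≤ J
    repeats      : p start ≡ p (start + period)
    injective    : ∀ {x y} → x < y → y < start + period → p x ≢ p y

firstRepetition : ∀ {A : Set} → DecidableEquality A → (p : ℕ → A) → ∀ {J} → 0 < J → p 0 ≡ p J →
                  FirstRepetition p J
firstRepetition _≟_ p {J} J>0 p₀≡pJ
  with leastWitness (λ j → anyUpTo? (λ i → p i ≟ p j) j) J (0 , J>0 , p₀≡pJ)
... | j , (i , i<j , pᵢ≡pⱼ) , j≤J , noEarlier with m≤n⇒∃[o]m+o≡n (<⇒≤ i<j)
... | ℓ , refl = record
  { start     = i
  ; period    = ℓ
  ; period>0  = +-cancelˡ-< i 0 ℓ (subst (_< i + ℓ) (sym (+-identityʳ i)) i<j)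
  ; bounded   = j≤J
  ; repeats   = pᵢ≡pⱼ
  ; injective = λ x<y y<i+ℓ pₓ≡p_y → noEarlier _ y<i+ℓ (_ , x<y , pₓ≡p_y)
  }

module _ (ℓ : ℕ) .{{_ : NonZero ℓ}} where

  suc-% : ∀ t → suc t % ℓ ≡ suc (t % ℓ) % ℓ
  suc-% t = trans (cong (λ x → suc x % ℓ) (m≡m%n+[m/n]*n t ℓ)) ([m+kn]%n≡m%n (suc (t % ℓ)) (t / ℓ) ℓ)

  suc-%-cases : ∀ t → suc t % ℓ ≡ suc (t % ℓ) ⊎ (suc (t % ℓ) ≡ ℓ × suc t % ℓ ≡ 0)
  suc-%-cases t with m≤n⇒m<n∨m≡n (m%n<n t ℓ)
  ... | inj₁ lt   = inj₁ (trans (suc-% t) (m<n⇒m%n≡m lt))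
  ... | inj₂ wrap = inj₂ (wrap , trans (suc-% t) (trans (cong (_% ℓ) wrap) (n%n≡0 ℓ)))

  %-≡⇒∣ : ∀ m t → (m + t) % ℓ ≡ m % ℓ → ℓ ∣ t
  %-≡⇒∣ m t eq = ∣m+n∣m⇒∣n (divides ((m + t) / ℓ) (+-cancelˡ-≡ (m % ℓ) _ _ shifted)) (n∣m*n (m / ℓ))
    where
    open ≡-Reasoning
    shifted : m % ℓ + (m / ℓ * ℓ + t) ≡ m % ℓ + (m + t) / ℓ * ℓ
    shifted = begin
      m % ℓ + (m / ℓ * ℓ + t)       ≡⟨ +-assoc (m % ℓ) _ t ⟨
      m % ℓ + m / ℓ * ℓ + t         ≡⟨ cong (_+ t) (m≡m%n+[m/n]*n m ℓ) ⟨
      m + t                         ≡⟨ m≡m%n+[m/n]*n (m + t) ℓ ⟩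
      (m + t) % ℓ + (m + t) / ℓ * ℓ ≡⟨ cong (_+ (m + t) / ℓ * ℓ) eq ⟩
      m % ℓ + (m + t) / ℓ * ℓ       ∎

  %-shift-≢ : ∀ m t → 0 < t → t < ℓ → (m + t) % ℓ ≢ m % ℓ
  %-shift-≢ m t@(suc _) _ t<ℓ eq = >⇒∤ t<ℓ (%-≡⇒∣ m t eq)

-- Connectivity in a punctured ball

module LocalConnectivity {n : ℕ} (Adj : Fin n → Fin n → Set) where
  open Graph Adj

  PuncturedEdge : ℕ → Fin n → Fin n → Fin n → Set
  PuncturedEdge r v x y = EdgeInBall r v x y × x ≢ v × y ≢ v

  Joined : ℕ → Fin n → Fin n → Fin n → Set
  Joined r v = Star (PuncturedEdge r v)

  module _ {r : ℕ} {v : Fin n} where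

    edgeInBall-sym : ∀ {x y} → EdgeInBall r v x y → EdgeInBall r v y x
    edgeInBall-sym (k , k≤r , w , closed , i , inj₁ ends) = k , k≤r , w , closed , i , inj₂ ends
    edgeInBall-sym (k , k≤r , w , closed , i , inj₂ ends) = k , k≤r , w , closed , i , inj₁ ends

    joined-sym : ∀ {x y} → Joined r v x y → Joined r v y x
    joined-sym = reverse λ (e , x≢v , y≢v) → edgeInBall-sym e , y≢v , x≢v

    joined⇒connected : ∀ {x y} → x ≢ v → Joined r v x y → ConnectedInBallMinus r v x y
    joined⇒connected {x} x≢v ε⋆ = 0 , (λ _ → x) , refl , refl , (λ _ → x≢v) , λ ()
    joined⇒connected {x} x≢v ((e , _ , y≢v) ◅ rest) with joined⇒connected y≢v rest
    ... | k , p , p₀ , pₖ , p≢v , edges = suc k , path , refl , pₖ , path≢v , path-edges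
      where
      path : Fin (suc (suc k)) → Fin n
      path fzero    = x
      path (fsuc i) = p i
      path≢v : ∀ i → path i ≢ v
      path≢v fzero    = x≢v
      path≢v (fsuc i) = p≢v i
      path-edges : ∀ (i : Fin (suc k)) → EdgeInBall r v (path (inject₁ i)) (path (fsuc i))
      path-edges fzero    = subst (EdgeInBall r v x) (sym p₀) e
      path-edges (fsuc i) = edges i

    NearCentre : Fin n → Set
    NearCentre x = x ≡ v ⊎ (x ≢ v × Σ (Fin n) λ y → Adj v y × Joined r v y x)

    nearCentre-step : ∀ {x y} → NearCentre x → Adj x y → EdgeInBall r v x y → NearCentre y
    nearCentre-step {y = y} _ _ _ with y ≟ᶠ v
    ... | yes y≡v = inj₁ y≡v
    nearCentre-step (inj₁ refl) vy _ | no y≢v = inj₂ (y≢v , _ , vy , ε⋆)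
    nearCentre-step (inj₂ (x≢v , z , vz , zx)) _ e | no y≢v =
      inj₂ (y≢v , z , vz , zx ◅◅ (e , x≢v , y≢v) ◅ ε⋆)

    -- Stated for any start near v, not only v itself, so that the induction can drop the first edge.
    walk-nearCentre : ∀ {k} (w : Fin (suc k) → Fin n) → NearCentre (w fzero) →
      (∀ (i : Fin k) → Adj (w (inject₁ i)) (w (fsuc i)) × EdgeInBall r v (w (inject₁ i)) (w (fsuc i))) →
      ∀ i → NearCentre (w i)
    walk-nearCentre w near _ fzero = near
    walk-nearCentre {suc k} w near edges (fsuc i) =
      walk-nearCentre (λ j → w (fsuc j)) (nearCentre-step near (proj₁ (edges fzero)) (proj₂ (edges fzero)))
        (λ j → edges (fsuc j)) i

    inBall-neighbour : ∀ {x} → InBall r v x → x ≢ v → Σ (Fin n) λ y → Adj v y × Joined r v y x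
    inBall-neighbour {x} (k , k≤r , w , closed@(walk , w₀ , _) , i , wᵢ) x≢v
      with walk-nearCentre w (inj₁ w₀) (λ j → walk j , (k , k≤r , w , closed , j , inj₁ (refl , refl))) i
    ... | inj₁ wᵢ≡v = ⊥-elim (x≢v (trans (sym wᵢ) wᵢ≡v))
    ... | inj₂ (_ , y , vy , yw) = y , vy , subst (Joined r v y) wᵢ yw

    neighboursJoined⇒¬localCutvertex : (∀ y z → Adj v y → Adj v z → Joined r v y z) → ¬ LocalCutvertex r v
    neighboursJoined⇒¬localCutvertex joined (x , y , x∈B , x≢v , y∈B , y≢v , ¬connected)
      with inBall-neighbour x∈B x≢v | inBall-neighbour y∈B y≢v
    ... | x₀ , vx₀ , x₀x | y₀ , vy₀ , y₀y =
      ¬connected (joined⇒connected x≢v (joined-sym x₀x ◅◅ joined x₀ y₀ vx₀ vy₀ ◅◅ y₀y))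

  record Excursion (r : ℕ) (v : Fin n) (ℓ : ℕ) (u : ℕ → Fin n) : Set where
    field
      short  : ℓ ≤ r
      start  : u 0 ≡ v
      end    : u ℓ ≡ v
      step   : ∀ t → t < ℓ → Adj (u t) (u (suc t))
      avoids : ∀ t → 0 < t → t < ℓ → u t ≢ v

    edgeInBall : ∀ t → t < ℓ → EdgeInBall r v (u t) (u (suc t))
    edgeInBall t t<ℓ = ℓ , short , w , (walk , start , trans (cong u (toℕ-fromℕ ℓ)) end) , fromℕ< t<ℓ , inj₁ ends
      where
      w : Fin (suc ℓ) → Fin n
      w i = u (toℕ i)
      walk : IsWalk ℓ w
      walk i = subst (λ j → Adj (u j) (u (suc (toℕ i)))) (sym (toℕ-inject₁ i)) (step (toℕ i) (toℕ<n i))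
      ends : w (inject₁ (fromℕ< t<ℓ)) ≡ u t × w (fsuc (fromℕ< t<ℓ)) ≡ u (suc t)
      ends = cong u (trans (toℕ-inject₁ _) (toℕ-fromℕ< t<ℓ)) , cong (λ j → u (suc j)) (toℕ-fromℕ< t<ℓ)

  excursion-joined : ∀ {r v k u} → Excursion r v (2 + k) u → Joined r v (u 1) (u (1 + k))
  excursion-joined {r} {v} {k} {u} E = along k ≤-refl
    where
    open Excursion E
    along : ∀ t → t ≤ k → Joined r v (u 1) (u (1 + t))
    along zero    _   = ε⋆
    along (suc t) t<k =
      along t (<⇒≤ t<k) ◅◅ (edge , avoids (1 + t) z<s t<ℓ , avoids (2 + t) z<s (s<s (s<s t<k))) ◅ ε⋆
      where
      t<ℓ : 1 + t < 2 + k
      t<ℓ = s<s (m<n⇒m<1+n t<k)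
      edge : EdgeInBall r v (u (1 + t)) (u (2 + t))
      edge = edgeInBall (1 + t) t<ℓ

asGroup : FinGroup → Group 0ℓ 0ℓ
asGroup Γ = record
  { Carrier = Fin (N Γ)
  ; _≈_     = _≡_
  ; _∙_     = FinGroup._∙_ Γ
  ; ε       = FinGroup.ε Γ
  ; _⁻¹     = FinGroup._⁻¹ Γ
  ; isGroup = isGroup Γ
  }

module FinGroupProperties (Γ : FinGroup) where
  open Group (asGroup Γ) public using (_∙_; ε; _⁻¹; assoc; identityˡ; identityʳ)
  open GroupProperties (asGroup Γ) public
  open ≡-Reasoning

  V : Set
  V = Fin (N Γ)

  infix 4 _≡±_
  _≡±_ : V → V → Set
  _≡±_ = Defs._≡±_ Γ

  ≡±-refl : ∀ {x} → x ≡± x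
  ≡±-refl = inj₁ refl

  ⁻¹-≡± : ∀ x → x ⁻¹ ≡± x
  ⁻¹-≡± x = inj₂ refl

  ≡±-sym : ∀ {x y} → x ≡± y → y ≡± x
  ≡±-sym (inj₁ refl) = ≡±-refl
  ≡±-sym (inj₂ refl) = inj₂ (sym (⁻¹-involutive _))

  ≡±-trans : ∀ {x y z} → x ≡± y → y ≡± z → x ≡± z
  ≡±-trans (inj₁ refl) y≡±z         = y≡±z
  ≡±-trans (inj₂ refl) (inj₁ refl)  = inj₂ refl
  ≡±-trans (inj₂ refl) (inj₂ refl)  = inj₁ (⁻¹-involutive _)

  _≡±?_ : ∀ x y → Dec (x ≡± y)
  x ≡±? y with x ≟ᶠ y | x ≟ᶠ y ⁻¹
  ... | yes x≡y | _         = yes (inj₁ x≡y)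
  ... | no _    | yes x≡y⁻¹ = yes (inj₂ x≡y⁻¹)
  ... | no x≢y  | no x≢y⁻¹  = no λ { (inj₁ x≡y) → x≢y x≡y ; (inj₂ x≡y⁻¹) → x≢y⁻¹ x≡y⁻¹ }

  ⁻¹-conjugate : ∀ x y → (x ⁻¹ ∙ (y ∙ x)) ⁻¹ ≡ x ⁻¹ ∙ (y ⁻¹ ∙ x)
  ⁻¹-conjugate x y = begin
    (x ⁻¹ ∙ (y ∙ x)) ⁻¹        ≡⟨ ⁻¹-anti-homo-∙ (x ⁻¹) (y ∙ x) ⟩
    (y ∙ x) ⁻¹ ∙ x ⁻¹ ⁻¹       ≡⟨ cong₂ _∙_ (⁻¹-anti-homo-∙ y x) (⁻¹-involutive x) ⟩
    x ⁻¹ ∙ y ⁻¹ ∙ x            ≡⟨ assoc (x ⁻¹) (y ⁻¹) x ⟩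
    x ⁻¹ ∙ (y ⁻¹ ∙ x)          ∎

  commutator-freeReduction : ∀ g t → g ∙ (g ∙ t) ⁻¹ ∙ g ⁻¹ ∙ (g ∙ t) ≡ g ∙ (t ⁻¹ ∙ (g ⁻¹ ∙ t))
  commutator-freeReduction g t = begin
    g ∙ (g ∙ t) ⁻¹ ∙ g ⁻¹ ∙ (g ∙ t)   ≡⟨ assoc (g ∙ (g ∙ t) ⁻¹) (g ⁻¹) (g ∙ t) ⟩
    g ∙ (g ∙ t) ⁻¹ ∙ (g ⁻¹ ∙ (g ∙ t)) ≡⟨ cong (g ∙ (g ∙ t) ⁻¹ ∙_) (\\-leftDividesʳ g t) ⟩
    g ∙ (g ∙ t) ⁻¹ ∙ t                ≡⟨ cong (λ x → g ∙ x ∙ t) (⁻¹-anti-homo-∙ g t) ⟩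
    g ∙ (t ⁻¹ ∙ g ⁻¹) ∙ t             ≡⟨ assoc g (t ⁻¹ ∙ g ⁻¹) t ⟩
    g ∙ (t ⁻¹ ∙ g ⁻¹ ∙ t)             ≡⟨ cong (g ∙_) (assoc (t ⁻¹) (g ⁻¹) t) ⟩
    g ∙ (t ⁻¹ ∙ (g ⁻¹ ∙ t))           ∎

  product-++ : ∀ xs ys → product Γ (xs ++ ys) ≡ product Γ xs ∙ product Γ ys
  product-++ []       ys = sym (identityˡ _)
  product-++ (x ∷ xs) ys = trans (cong (x ∙_) (product-++ xs ys)) (sym (assoc x _ _))

  -- Indices past the end read as ε; every use below is guarded by a bound on the index.
  _!_ : List V → ℕ → V
  []       ! _     = ε
  (x ∷ _)  ! zero  = x
  (_ ∷ xs) ! suc t = xs ! t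

  product-take-suc : ∀ xs {t} → t < length xs → product Γ (take (suc t) xs) ≡ product Γ (take t xs) ∙ xs ! t
  product-take-suc (x ∷ xs) {zero}  _         = trans (identityʳ x) (sym (identityˡ x))
  product-take-suc (x ∷ xs) {suc t} (s≤s t<n) =
    trans (cong (x ∙_) (product-take-suc xs t<n)) (sym (assoc x _ _))

  pow-+ : ∀ a m n → pow Γ a (m + n) ≡ pow Γ a m ∙ pow Γ a n
  pow-+ a zero    n = sym (identityˡ _)
  pow-+ a (suc m) n = trans (cong (a ∙_) (pow-+ a m n)) (sym (assoc a _ _))

  pow-suc : ∀ a n → pow Γ a (suc n) ≡ pow Γ a n ∙ a
  pow-suc a n = trans (cong (pow Γ a) (+-comm 1 n)) (trans (pow-+ a n 1) (cong (pow Γ a n ∙_) (identityʳ a)))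

  record IsOrder (a : V) (m : ℕ) : Set where
    field
      positive : 0 < m
      pow-m    : pow Γ a m ≡ ε
      minimal  : ∀ k → 0 < k → k < m → pow Γ a k ≢ ε

    instance
      m-nonZero : NonZero m
      m-nonZero = >-nonZero positive

    pow-multiple : ∀ q → pow Γ a (q * m) ≡ ε
    pow-multiple zero    = refl
    pow-multiple (suc q) = trans (pow-+ a m (q * m)) (trans (cong₂ _∙_ pow-m (pow-multiple q)) (identityˡ ε))

    pow-% : ∀ k → pow Γ a k ≡ pow Γ a (k % m)
    pow-% k = begin
      pow Γ a k                                ≡⟨ cong (pow Γ a) (m≡m%n+[m/n]*n k m) ⟩
      pow Γ a (k % m + k / m * m)              ≡⟨ pow-+ a (k % m) (k / m * m) ⟩
      pow Γ a (k % m) ∙ pow Γ a (k / m * m)    ≡⟨ cong (pow Γ a (k % m) ∙_) (pow-multiple (k / m)) ⟩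
      pow Γ a (k % m) ∙ ε                      ≡⟨ identityʳ _ ⟩
      pow Γ a (k % m)                          ∎

    pow-periodic : ∀ t → pow Γ a (t + m) ≡ pow Γ a t
    pow-periodic t = trans (pow-+ a t m) (trans (cong (pow Γ a t ∙_) pow-m) (identityʳ _))

    pow-pred : pow Γ a (m ∸ 1) ≡ a ⁻¹
    pow-pred = inverseʳ-unique a _ (trans (cong (pow Γ a) (m+[n∸m]≡n positive)) pow-m)

    pow-shift-≢ : ∀ x t → 0 < t → t < m → pow Γ a (x + t) ≢ pow Γ a x
    pow-shift-≢ x t t>0 t<m eq =
      minimal t t>0 t<m (identityʳ-unique (pow Γ a x) _ (trans (sym (pow-+ a x t)) eq))

    pow-injective : ∀ {x y} → x < m → y < m → pow Γ a x ≡ pow Γ a y → x ≡ y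
    pow-injective {x} {y} x<m y<m eq with <-cmp x y
    ... | tri≈ _ x≡y _ = x≡y
    ... | tri< x<y _ _ = ⊥-elim (pow-shift-≢ x (y ∸ x) (m<n⇒0<n∸m x<y) (≤-<-trans (m∸n≤m y x) y<m)
                           (trans (cong (pow Γ a) (m+[n∸m]≡n (<⇒≤ x<y))) (sym eq)))
    ... | tri> _ _ y<x = ⊥-elim (pow-shift-≢ y (x ∸ y) (m<n⇒0<n∸m y<x) (≤-<-trans (m∸n≤m x y) x<m)
                           (trans (cong (pow Γ a) (m+[n∸m]≡n (<⇒≤ y<x))) eq))

  finiteOrder : ∀ a → Σ ℕ (IsOrder a)
  finiteOrder a with pigeonhole (n<1+n (N Γ)) (λ i → pow Γ a (toℕ i))
  ... | i , j , i<j , eq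
    with leastWitness (λ d → (0 <? d) ×-dec (pow Γ a d ≟ᶠ ε)) (toℕ j ∸ toℕ i) (m<n⇒0<n∸m i<j , cycle)
    where
    cycle : pow Γ a (toℕ j ∸ toℕ i) ≡ ε
    cycle = identityʳ-unique (pow Γ a (toℕ i)) _
      (trans (sym (pow-+ a (toℕ i) _)) (trans (cong (pow Γ a) (m+[n∸m]≡n (<⇒≤ i<j))) (sym eq)))
  ... | m , (m>0 , pow-m) , _ , least = m , record
    { positive = m>0
    ; pow-m    = pow-m
    ; minimal  = λ k k>0 k<m pow-k → least k k<m (k>0 , pow-k)
    }

module QuadLinking (Γ : FinGroup) {R : Fin (N Γ) → Fin (N Γ) → Set} (R-isEquivalence : IsEquivalence R) where
  open FinGroupProperties Γ
  open IsEquivalence R-isEquivalence renaming (refl to ~-refl; sym to ~-sym; trans to ~-trans)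

  infix 4 _~_
  _~_ : V → V → Set
  _~_ = R

  Quad : V → V → V → Set
  Quad x y s = s ≡± x ⊎ s ≡± y

  FullyLinked : V → V → Set
  FullyLinked x y = ∀ s t → Quad x y s → Quad x y t → s ~ t

  fullyLinked : ∀ {x y} → x ~ x ⁻¹ → x ~ y → x ~ y ⁻¹ → FullyLinked x y
  fullyLinked {x} {y} xx⁻¹ xy xy⁻¹ s t s∈Q t∈Q = ~-trans (~-sym (fromX s∈Q)) (fromX t∈Q)
    where
    fromX : ∀ {s} → Quad x y s → x ~ s
    fromX (inj₁ (inj₁ refl)) = ~-refl
    fromX (inj₁ (inj₂ refl)) = xx⁻¹
    fromX (inj₂ (inj₁ refl)) = xy
    fromX (inj₂ (inj₂ refl)) = xy⁻¹

  fullyLinked-resp : ∀ {x y x′ y′} → x ≡± x′ → y ≡± y′ → FullyLinked x y → FullyLinked x′ y′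
  fullyLinked-resp x≡±x′ y≡±y′ linked s t s∈Q t∈Q = linked s t (shrink s∈Q) (shrink t∈Q)
    where
    shrink : ∀ {s} → Quad _ _ s → Quad _ _ s
    shrink (inj₁ s≡±x′) = inj₁ (≡±-trans s≡±x′ (≡±-sym x≡±x′))
    shrink (inj₂ s≡±y′) = inj₂ (≡±-trans s≡±y′ (≡±-sym y≡±y′))

  fullyLinked-swap : ∀ {x y} → FullyLinked x y → FullyLinked y x
  fullyLinked-swap linked s t s∈Q t∈Q = linked s t (swap s∈Q) (swap t∈Q)
    where
    swap : ∀ {x y s} → Quad x y s → Quad y x s
    swap (inj₁ s≡±x) = inj₂ s≡±x
    swap (inj₂ s≡±y) = inj₁ s≡±y

  triangle-fullyLinked : ∀ {x y z} → (x ∙ y) ∙ z ≡ ε → y ≢ ε → z ≡± x →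
                         y ~ x ⁻¹ → z ~ y ⁻¹ → x ~ z ⁻¹ → FullyLinked x y
  triangle-fullyLinked _ _ (inj₁ refl) yx⁻¹ xy⁻¹ xx⁻¹ = fullyLinked xx⁻¹ (~-trans xx⁻¹ (~-sym yx⁻¹)) xy⁻¹
  triangle-fullyLinked {x} {y} closes y≢ε (inj₂ refl) _ _ _ =
    ⊥-elim (y≢ε (identityʳ-unique x y (trans (inverseˡ-unique (x ∙ y) (x ⁻¹) closes) (⁻¹-involutive x))))

  invertedSquare-fullyLinked : ∀ {x y w} → y ~ x ⁻¹ → x ⁻¹ ~ y ⁻¹ → w ~ x ⁻¹ ⁻¹ → w ≡± y → FullyLinked x y
  invertedSquare-fullyLinked {x} {y} yx⁻¹ x⁻¹y⁻¹ wx⁻¹⁻¹ (inj₁ refl) =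
    fullyLinked xx⁻¹ xy (~-trans xx⁻¹ x⁻¹y⁻¹)
    where
    xy : x ~ y
    xy = ~-sym (subst (_ ~_) (⁻¹-involutive x) wx⁻¹⁻¹)
    xx⁻¹ : x ~ x ⁻¹
    xx⁻¹ = ~-trans xy yx⁻¹
  invertedSquare-fullyLinked {x} {y} yx⁻¹ x⁻¹y⁻¹ wx⁻¹⁻¹ (inj₂ refl) =
    fullyLinked xx⁻¹ (~-trans xx⁻¹ (~-sym yx⁻¹)) xy⁻¹
    where
    xy⁻¹ : x ~ y ⁻¹
    xy⁻¹ = ~-sym (subst (_ ~_) (⁻¹-involutive x) wx⁻¹⁻¹)
    xx⁻¹ : x ~ x ⁻¹
    xx⁻¹ = ~-trans xy⁻¹ (~-sym x⁻¹y⁻¹)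

  square-fullyLinked : ∀ {x y z w} → y ~ x ⁻¹ → z ~ y ⁻¹ → w ~ z ⁻¹ → z ≡± x → w ≡± y →
                       z ≡ x ⁻¹ ⊎ w ≡ y ⁻¹ → FullyLinked x y
  square-fullyLinked yx⁻¹ zy⁻¹ wz⁻¹ _ w≡±y (inj₁ refl) =
    invertedSquare-fullyLinked yx⁻¹ zy⁻¹ wz⁻¹ w≡±y
  square-fullyLinked yx⁻¹ zy⁻¹ wz⁻¹ (inj₂ refl) w≡±y (inj₂ _) =
    invertedSquare-fullyLinked yx⁻¹ zy⁻¹ wz⁻¹ w≡±y
  square-fullyLinked {x} yx⁻¹ xy⁻¹ y⁻¹x⁻¹ (inj₁ refl) _ (inj₂ refl) =
    fullyLinked xx⁻¹ (~-trans xx⁻¹ (~-sym yx⁻¹)) xy⁻¹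
    where
    xx⁻¹ : x ~ x ⁻¹
    xx⁻¹ = ~-trans xy⁻¹ y⁻¹x⁻¹

  fullyLinked⇒allLinked : ∀ {P : V → Set} {g h} → P g → P h → ¬ g ≡± h →
                          (∀ x y → P x → P y → ¬ x ≡± y → FullyLinked x y) → ∀ s t → P s → P t → s ~ t
  fullyLinked⇒allLinked {P} {g} {h} Pg Ph g≢±h fully s t Ps Pt = ~-trans (~-sym (fromG s Ps)) (fromG t Pt)
    where
    fromG : ∀ s → P s → g ~ s
    fromG s Ps with s ≡±? g
    ... | yes s≡±g = fully g h Pg Ph g≢±h g s (inj₁ ≡±-refl) (inj₁ s≡±g)
    ... | no  s≢±g = fully g s Pg Ps (λ g≡±s → s≢±g (≡±-sym g≡±s)) g s (inj₁ ≡±-refl) (inj₂ ≡±-refl)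

-- Simple cycles in Cayley graphs

module Cayley (Γ : FinGroup) (S : Subset (N Γ)) where
  open FinGroupProperties Γ
  open Graph (Cay Γ S)
  open LocalConnectivity (Cay Γ S)
  open ≡-Reasoning

  Linked : ℕ → V → V → V → Set
  Linked r v s t = Joined r v (v ∙ s) (v ∙ t)

  linked-isEquivalence : ∀ {r v} → IsEquivalence (Linked r v)
  linked-isEquivalence = record { refl = ε⋆ ; sym = joined-sym ; trans = _◅◅_ }

  allLinked⇒¬localCutvertex : ∀ {r v} → (∀ s t → s ∈ S → t ∈ S → Linked r v s t) → ¬ LocalCutvertex r v
  allLinked⇒¬localCutvertex linked =
    neighboursJoined⇒¬localCutvertex λ { _ _ (s , s∈S , refl) (t , t∈S , refl) → linked s t s∈S t∈S }

  localCutvertex⇒generator : ∀ {r v} → LocalCutvertex r v → Σ V (_∈ S)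
  localCutvertex⇒generator (_ , _ , x∈B , x≢v , _) with inBall-neighbour x∈B x≢v
  ... | _ , (s , s∈S , _) , _ = s , s∈S

  generators-dichotomy : ∀ {a} → a ∈ S → (Σ V λ h → h ∈ S × ¬ a ≡± h) ⊎ (∀ s → s ∈ S → s ≡± a)
  generators-dichotomy {a} a∈S with any? (λ s → (s ∈? S) ×-dec ¬? (a ≡±? s))
  ... | yes (h , h∈S , a≢±h) = inj₁ (h , h∈S , a≢±h)
  ... | no none = inj₂ λ s s∈S → ≡±-sym (decidable-stable (a ≡±? s) λ a≢±s → none (s , s∈S , a≢±s))

  -- Indexed by ℕ and ℓ-periodic, so that the cycle can be entered at any of its vertices.
  record SimpleCycle (ℓ : ℕ) : Set where
    field
      vertex   : ℕ → V
      letter   : ℕ → V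
      letter∈S : ∀ t → letter t ∈ S
      step     : ∀ t → vertex (suc t) ≡ vertex t ∙ letter t
      periodic : ∀ t → vertex (t + ℓ) ≡ vertex t
      simple   : ∀ m t → 0 < t → t < ℓ → vertex (m + t) ≢ vertex m

    letter-periodic : ∀ t → letter (t + ℓ) ≡ letter t
    letter-periodic t = ∙-cancelˡ (vertex t) _ _ (begin
      vertex t ∙ letter (t + ℓ)        ≡⟨ cong (_∙ letter (t + ℓ)) (periodic t) ⟨
      vertex (t + ℓ) ∙ letter (t + ℓ)  ≡⟨ step (t + ℓ) ⟨
      vertex (suc t + ℓ)               ≡⟨ periodic (suc t) ⟩
      vertex (suc t)                   ≡⟨ step t ⟩
      vertex t ∙ letter t              ∎)

    prefixProduct : ℕ → V
    prefixProduct zero    = ε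
    prefixProduct (suc t) = prefixProduct t ∙ letter t

    vertex-prefixProduct : ∀ t → vertex t ≡ vertex 0 ∙ prefixProduct t
    vertex-prefixProduct zero    = sym (identityʳ (vertex 0))
    vertex-prefixProduct (suc t) =
      trans (step t) (trans (cong (_∙ letter t) (vertex-prefixProduct t)) (assoc (vertex 0) _ _))

    period-product : prefixProduct ℓ ≡ ε
    period-product = identityʳ-unique (vertex 0) _ (trans (sym (vertex-prefixProduct ℓ)) (periodic 0))

  -- Translating the cycle so that its vertex `suc m` lands on v gives an excursion from v
  -- leaving along letter (suc m) and returning along letter m.
  simpleCycle-linked : ∀ {ℓ r} v (C : SimpleCycle ℓ) → 2 ≤ ℓ → ℓ ≤ r →
                       ∀ m → Linked r v (SimpleCycle.letter C (suc m)) (SimpleCycle.letter C m ⁻¹)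
  simpleCycle-linked {1} _ _ (s≤s ()) _ _
  simpleCycle-linked {suc (suc k)} {r} v C _ ℓ≤r m = subst₂ (Joined r v) first last (excursion-joined excursion)
    where
    open SimpleCycle C
    z : V
    z = v ∙ vertex (suc m) ⁻¹
    u : ℕ → V
    u t = z ∙ vertex (suc m + t)
    back : z ∙ vertex (suc m) ≡ v
    back = //-rightDividesˡ (vertex (suc m)) v
    move : ∀ t → u (suc t) ≡ u t ∙ letter (suc m + t)
    move t = begin
      z ∙ vertex (suc m + suc t)                          ≡⟨ cong (λ j → z ∙ vertex j) (+-suc (suc m) t) ⟩
      z ∙ vertex (suc (suc m + t))                        ≡⟨ cong (z ∙_) (step (suc m + t)) ⟩
      z ∙ (vertex (suc m + t) ∙ letter (suc m + t))       ≡⟨ assoc z _ _ ⟨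
      u t ∙ letter (suc m + t)                            ∎
    excursion : Excursion r v (2 + k) u
    excursion = record
      { short  = ℓ≤r
      ; start  = trans (cong (λ j → z ∙ vertex j) (+-identityʳ (suc m))) back
      ; end    = trans (cong (z ∙_) (periodic (suc m))) back
      ; step   = λ t _ → letter (suc m + t) , letter∈S (suc m + t) , move t
      ; avoids = λ t t>0 t<ℓ uₜ≡v → simple (suc m) t t>0 t<ℓ (∙-cancelˡ z _ _ (trans uₜ≡v (sym back)))
      }
    first : u 1 ≡ v ∙ letter (suc m)
    first = begin
      z ∙ vertex (suc m + 1)                 ≡⟨ move 0 ⟩
      z ∙ vertex (suc m + 0) ∙ letter (suc m + 0) ≡⟨ cong (λ j → z ∙ vertex j ∙ letter j) (+-identityʳ (suc m)) ⟩
      z ∙ vertex (suc m) ∙ letter (suc m)    ≡⟨ cong (_∙ letter (suc m)) back ⟩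
      v ∙ letter (suc m)                     ∎
    last : u (1 + k) ≡ v ∙ letter m ⁻¹
    last = begin
      z ∙ vertex (suc m + suc k)             ≡⟨ cong (λ j → z ∙ vertex j) (+-suc m (suc k)) ⟨
      z ∙ vertex (m + suc (suc k))           ≡⟨ cong (z ∙_) (periodic m) ⟩
      z ∙ vertex m                           ≡⟨ cong (z ∙_) (x≈z//y (vertex m) (letter m) _ (sym (step m))) ⟩
      z ∙ (vertex (suc m) ∙ letter m ⁻¹)     ≡⟨ assoc z _ _ ⟨
      z ∙ vertex (suc m) ∙ letter m ⁻¹       ≡⟨ cong (_∙ letter m ⁻¹) back ⟩
      v ∙ letter m ⁻¹                        ∎

  module PeriodicExtension {J} {p a : ℕ → V} (a∈S : ∀ t → t < J → a t ∈ S)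
                           (walk : ∀ t → t < J → p (suc t) ≡ p t ∙ a t) (R : FirstRepetition p J) where
    open FirstRepetition R renaming (start to i; period to ℓ)

    instance
      ℓ-nonZero : NonZero ℓ
      ℓ-nonZero = >-nonZero period>0

    inCycle : ∀ {q} → q < ℓ → i + q < J
    inCycle q<ℓ = <-≤-trans (+-monoʳ-< i q<ℓ) bounded

    advance : ∀ {q} → q < ℓ → p (i + suc q) ≡ p (i + q) ∙ a (i + q)
    advance {q} q<ℓ = trans (cong p (+-suc i q)) (walk (i + q) (inCycle q<ℓ))

    offsets-injective : ∀ {x y} → x < ℓ → y < ℓ → p (i + x) ≡ p (i + y) → x ≡ y
    offsets-injective {x} {y} x<ℓ y<ℓ eq with <-cmp x y
    ... | tri< x<y _ _ = ⊥-elim (injective (+-monoʳ-< i x<y) (+-monoʳ-< i y<ℓ) eq)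
    ... | tri≈ _ x≡y _ = x≡y
    ... | tri> _ _ y<x = ⊥-elim (injective (+-monoʳ-< i y<x) (+-monoʳ-< i x<ℓ) (sym eq))

    step : ∀ t → p (i + suc t % ℓ) ≡ p (i + t % ℓ) ∙ a (i + t % ℓ)
    step t with suc-%-cases ℓ t
    ... | inj₁ no-wrap = trans (cong (λ j → p (i + j)) no-wrap) (advance (m%n<n t ℓ))
    ... | inj₂ (wrap , to-start) = begin
      p (i + suc t % ℓ)        ≡⟨ cong (λ j → p (i + j)) to-start ⟩
      p (i + 0)                ≡⟨ cong p (+-identityʳ i) ⟩
      p i                      ≡⟨ repeats ⟩
      p (i + ℓ)                ≡⟨ cong (λ j → p (i + j)) wrap ⟨
      p (i + suc (t % ℓ))      ≡⟨ advance (m%n<n t ℓ) ⟩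
      p (i + t % ℓ) ∙ a (i + t % ℓ) ∎

    periodicExtension : SimpleCycle ℓ
    periodicExtension = record
      { vertex   = λ t → p (i + t % ℓ)
      ; letter   = λ t → a (i + t % ℓ)
      ; letter∈S = λ t → a∈S _ (inCycle (m%n<n t ℓ))
      ; step     = step
      ; periodic = λ t → cong (λ j → p (i + j)) ([m+n]%n≡m%n t ℓ)
      ; simple   = λ m t t>0 t<ℓ eq →
          %-shift-≢ ℓ m t t>0 t<ℓ (offsets-injective (m%n<n (m + t) ℓ) (m%n<n m ℓ) eq)
      }

    periodicExtension-letter : ∀ t → t < ℓ → SimpleCycle.letter periodicExtension t ≡ a (i + t)
    periodicExtension-letter t t<ℓ = cong (λ j → a (i + j)) (m<n⇒m%n≡m t<ℓ)

-- The word of the iterated commutator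

module CommutatorWord (Γ : FinGroup) (g h : Fin (N Γ)) where
  open FinGroupProperties Γ
  open ≡-Reasoning

  -- With c = [g,h]_k written g T, the word g c⁻¹ g⁻¹ c = g T⁻¹ g⁻¹ g⁻¹ g T of [g,h]_(k+1) freely
  -- reduces to g T⁻¹ g⁻¹ T; commTail⁻¹ k is the formal inverse of commTail k.
  commTail   : ℕ → List V
  commTail⁻¹ : ℕ → List V
  commTail zero      = h ⁻¹ ∷ g ⁻¹ ∷ h ∷ []
  commTail (suc k)   = commTail⁻¹ k ++ g ⁻¹ ∷ commTail k
  commTail⁻¹ zero    = h ⁻¹ ∷ g ∷ h ∷ []
  commTail⁻¹ (suc k) = commTail⁻¹ k ++ g ∷ commTail k

  commWord : ℕ → List V
  commWord k = g ∷ commTail k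

  commTail⁻¹-product : ∀ k → product Γ (commTail⁻¹ k) ≡ product Γ (commTail k) ⁻¹
  commTail⁻¹-product zero = begin
    h ⁻¹ ∙ (g ∙ (h ∙ ε))              ≡⟨ cong (λ x → h ⁻¹ ∙ (g ∙ x)) (identityʳ h) ⟩
    h ⁻¹ ∙ (g ∙ h)                    ≡⟨ cong (λ x → h ⁻¹ ∙ (x ∙ h)) (⁻¹-involutive g) ⟨
    h ⁻¹ ∙ (g ⁻¹ ⁻¹ ∙ h)              ≡⟨ ⁻¹-conjugate h (g ⁻¹) ⟨
    (h ⁻¹ ∙ (g ⁻¹ ∙ h)) ⁻¹            ≡⟨ cong (λ x → (h ⁻¹ ∙ (g ⁻¹ ∙ x)) ⁻¹) (identityʳ h) ⟨
    (h ⁻¹ ∙ (g ⁻¹ ∙ (h ∙ ε))) ⁻¹      ∎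
  commTail⁻¹-product (suc k) = begin
    product Γ (commTail⁻¹ k ++ g ∷ commTail k)      ≡⟨ product-++ (commTail⁻¹ k) _ ⟩
    product Γ (commTail⁻¹ k) ∙ (g ∙ T)              ≡⟨ cong (_∙ (g ∙ T)) (commTail⁻¹-product k) ⟩
    T ⁻¹ ∙ (g ∙ T)                                  ≡⟨ cong (λ x → T ⁻¹ ∙ (x ∙ T)) (⁻¹-involutive g) ⟨
    T ⁻¹ ∙ (g ⁻¹ ⁻¹ ∙ T)                            ≡⟨ ⁻¹-conjugate T (g ⁻¹) ⟨
    (T ⁻¹ ∙ (g ⁻¹ ∙ T)) ⁻¹                          ≡⟨ cong (λ x → (x ∙ (g ⁻¹ ∙ T)) ⁻¹) (commTail⁻¹-product k) ⟨
    (product Γ (commTail⁻¹ k) ∙ (g ⁻¹ ∙ T)) ⁻¹      ≡⟨ cong _⁻¹ (product-++ (commTail⁻¹ k) _) ⟨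
    product Γ (commTail⁻¹ k ++ g ⁻¹ ∷ commTail k) ⁻¹ ∎
    where
    T : V
    T = product Γ (commTail k)

  commWord-product : ∀ k → product Γ (commWord k) ≡ comm Γ (suc k) g h
  commWord-product zero = begin
    g ∙ (h ⁻¹ ∙ (g ⁻¹ ∙ (h ∙ ε)))     ≡⟨ cong (λ x → g ∙ (h ⁻¹ ∙ (g ⁻¹ ∙ x))) (identityʳ h) ⟩
    g ∙ (h ⁻¹ ∙ (g ⁻¹ ∙ h))           ≡⟨ assoc g (h ⁻¹) (g ⁻¹ ∙ h) ⟨
    g ∙ h ⁻¹ ∙ (g ⁻¹ ∙ h)             ≡⟨ assoc (g ∙ h ⁻¹) (g ⁻¹) h ⟨
    g ∙ h ⁻¹ ∙ g ⁻¹ ∙ h               ∎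
  commWord-product (suc k) = begin
    g ∙ product Γ (commTail⁻¹ k ++ g ⁻¹ ∷ commTail k) ≡⟨ cong (g ∙_) (product-++ (commTail⁻¹ k) _) ⟩
    g ∙ (product Γ (commTail⁻¹ k) ∙ (g ⁻¹ ∙ T))       ≡⟨ cong (λ x → g ∙ (x ∙ (g ⁻¹ ∙ T))) (commTail⁻¹-product k) ⟩
    g ∙ (T ⁻¹ ∙ (g ⁻¹ ∙ T))                           ≡⟨ commutator-freeReduction g T ⟨
    g ∙ (g ∙ T) ⁻¹ ∙ g ⁻¹ ∙ (g ∙ T)                   ≡⟨ cong (λ c → g ∙ c ⁻¹ ∙ g ⁻¹ ∙ c) (commWord-product k) ⟩
    comm Γ (suc (suc k)) g h                          ∎
    where
    T : V
    T = product Γ (commTail k)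

  commTail⁻¹-length : ∀ k → length (commTail⁻¹ k) ≡ length (commTail k)
  commTail⁻¹-length zero    = refl
  commTail⁻¹-length (suc k) = trans (length-++ (commTail⁻¹ k)) (sym (length-++ (commTail⁻¹ k)))

  commWord-length : ∀ k → length (commWord k) ≡ 2 ^ (suc k + 1)
  commWord-length zero    = refl
  commWord-length (suc k) = begin
    suc (length (commTail⁻¹ k ++ g ⁻¹ ∷ commTail k))    ≡⟨ cong suc (length-++ (commTail⁻¹ k)) ⟩
    suc (length (commTail⁻¹ k) + length (commWord k))   ≡⟨ cong (λ n → suc (n + length (commWord k))) (commTail⁻¹-length k) ⟩
    length (commWord k) + length (commWord k)           ≡⟨ cong (λ n → n + n) (commWord-length k) ⟩
    2 ^ (suc k + 1) + 2 ^ (suc k + 1)                   ≡⟨ cong (2 ^ (suc k + 1) +_) (+-identityʳ _) ⟨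
    2 ^ (suc (suc k) + 1)                               ∎

  data Blocks : List V → Set where
    []    : Blocks []
    block : ∀ {x y ws} → x ≡± g → y ≡± g → Blocks ws → Blocks (x ∷ h ⁻¹ ∷ y ∷ h ∷ ws)

  blocks-++ : ∀ {xs ys} → Blocks xs → Blocks ys → Blocks (xs ++ ys)
  blocks-++ []               ys = ys
  blocks-++ (block x y xs) ys = block x y (blocks-++ xs ys)

  commTail-blocks   : ∀ k {x} → x ≡± g → Blocks (x ∷ commTail k)
  commTail⁻¹-blocks : ∀ k {x} → x ≡± g → Blocks (x ∷ commTail⁻¹ k)
  commTail-blocks zero        x≡±g = block x≡±g (⁻¹-≡± g) []
  commTail-blocks (suc k)     x≡±g = blocks-++ (commTail⁻¹-blocks k x≡±g) (commTail-blocks k (⁻¹-≡± g))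
  commTail⁻¹-blocks zero      x≡±g = block x≡±g ≡±-refl []
  commTail⁻¹-blocks (suc k)   x≡±g = blocks-++ (commTail⁻¹-blocks k x≡±g) (commTail-blocks k ≡±-refl)

  commWord-blocks : ∀ k → Blocks (commWord k)
  commWord-blocks k = commTail-blocks k ≡±-refl

  Alternate : V → V → Set
  Alternate x y = (x ≡± g × y ≡± h) ⊎ (x ≡± h × y ≡± g)

  blocks-letter : ∀ {ws} → Blocks ws → ∀ t → t < length ws → ws ! t ≡± g ⊎ ws ! t ≡± h
  blocks-letter (block x≡±g _ _) 0 _ = inj₁ x≡±g
  blocks-letter (block _ _ _)    1 _ = inj₂ (⁻¹-≡± h)
  blocks-letter (block _ y≡±g _) 2 _ = inj₁ y≡±g
  blocks-letter (block _ _ _)    3 _ = inj₂ ≡±-refl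
  blocks-letter (block _ _ bs) (suc (suc (suc (suc t)))) (s≤s (s≤s (s≤s (s≤s t<n)))) = blocks-letter bs t t<n

  blocks-window₂ : ∀ {ws} → Blocks ws → ∀ t → t + 1 < length ws → Alternate (ws ! t) (ws ! (t + 1))
  blocks-window₂ (block x≡±g _ _)              0 _ = inj₁ (x≡±g , ⁻¹-≡± h)
  blocks-window₂ (block _ y≡±g _)              1 _ = inj₂ (⁻¹-≡± h , y≡±g)
  blocks-window₂ (block _ y≡±g _)              2 _ = inj₁ (y≡±g , ≡±-refl)
  blocks-window₂ (block _ _ (block x≡±g _ _))  3 _ = inj₂ (≡±-refl , x≡±g)
  blocks-window₂ (block _ _ []) 3 (s≤s (s≤s (s≤s (s≤s ()))))
  blocks-window₂ (block _ _ bs) (suc (suc (suc (suc t)))) (s≤s (s≤s (s≤s (s≤s t<n)))) = blocks-window₂ bs t t<n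

  blocks-window₃ : ∀ {ws} → Blocks ws → ∀ t → t + 2 < length ws → ws ! (t + 2) ≡± ws ! t
  blocks-window₃ (block x≡±g y≡±g _)             0 _ = ≡±-trans y≡±g (≡±-sym x≡±g)
  blocks-window₃ (block _ _ _)                   1 _ = ≡±-sym (⁻¹-≡± h)
  blocks-window₃ (block _ y≡±g (block x≡±g _ _)) 2 _ = ≡±-trans x≡±g (≡±-sym y≡±g)
  blocks-window₃ (block _ _ (block _ _ _))       3 _ = ⁻¹-≡± h
  blocks-window₃ (block _ _ []) 2 (s≤s (s≤s (s≤s (s≤s ()))))
  blocks-window₃ (block _ _ []) 3 (s≤s (s≤s (s≤s (s≤s ()))))
  blocks-window₃ (block _ _ bs) (suc (suc (suc (suc t)))) (s≤s (s≤s (s≤s (s≤s t<n)))) = blocks-window₃ bs t t<n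

  -- Every window of four letters contains h⁻¹ and h two apart.
  blocks-window₄ : ∀ {ws} → Blocks ws → ∀ t → t + 3 < length ws →
                   ws ! (t + 3) ≡± ws ! (t + 1) × (ws ! (t + 2) ≡ ws ! t ⁻¹ ⊎ ws ! (t + 3) ≡ ws ! (t + 1) ⁻¹)
  blocks-window₄ (block _ _ _)                         0 _ = ≡±-sym (⁻¹-≡± h) , inj₂ (sym (⁻¹-involutive h))
  blocks-window₄ (block _ y≡±g (block x≡±g _ _))       1 _ = ≡±-trans x≡±g (≡±-sym y≡±g) , inj₁ (sym (⁻¹-involutive h))
  blocks-window₄ (block _ _ (block _ _ _))             2 _ = ⁻¹-≡± h , inj₂ refl
  blocks-window₄ (block _ _ (block x≡±g y≡±g _))       3 _ = ≡±-trans y≡±g (≡±-sym x≡±g) , inj₁ refl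
  blocks-window₄ (block _ _ []) 1 (s≤s (s≤s (s≤s (s≤s ()))))
  blocks-window₄ (block _ _ []) 2 (s≤s (s≤s (s≤s (s≤s ()))))
  blocks-window₄ (block _ _ []) 3 (s≤s (s≤s (s≤s (s≤s ()))))
  blocks-window₄ (block _ _ bs) (suc (suc (suc (suc t)))) (s≤s (s≤s (s≤s (s≤s t<n)))) = blocks-window₄ bs t t<n

-- Two generators that are distinct up to inversion

module TwoGenerators (Γ : FinGroup) (S : Subset (N Γ)) (isGen : IsGeneratingSet Γ S) {r : ℕ} (v : Fin (N Γ)) where
  open FinGroupProperties Γ
  open Cayley Γ S
  open IsGeneratingSet isGen
  open QuadLinking Γ (linked-isEquivalence {r} {v})

  ∈S⇒≢ε : ∀ {s} → s ∈ S → s ≢ ε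
  ∈S⇒≢ε s∈S refl = noIdentity s∈S

  module _ {g h} (g∈S : g ∈ S) (h∈S : h ∈ S) (g≢±h : ¬ g ≡± h) where
    open CommutatorWord Γ g h

    ≡±-∈S : ∀ {x y} → y ∈ S → x ≡± y → x ∈ S
    ≡±-∈S y∈S (inj₁ refl) = y∈S
    ≡±-∈S y∈S (inj₂ refl) = inverseClosed _ y∈S

    alternate-≢± : ∀ {x y} → Alternate x y → ¬ y ≡± x
    alternate-≢± (inj₁ (x≡±g , y≡±h)) y≡±x = g≢±h (≡±-trans (≡±-sym x≡±g) (≡±-trans (≡±-sym y≡±x) y≡±h))
    alternate-≢± (inj₂ (x≡±h , y≡±g)) y≡±x = g≢±h (≡±-trans (≡±-sym y≡±g) (≡±-trans y≡±x x≡±h))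

    alternate-fullyLinked : ∀ {x y} → Alternate x y → FullyLinked x y → FullyLinked g h
    alternate-fullyLinked (inj₁ (x≡±g , y≡±h)) linked = fullyLinked-resp x≡±g y≡±h linked
    alternate-fullyLinked (inj₂ (x≡±h , y≡±g)) linked = fullyLinked-swap (fullyLinked-resp x≡±h y≡±g linked)

    module CycleInWord (w : List V) (w-blocks : Blocks w) {i ℓ} (C : SimpleCycle ℓ) (ℓ≤r : ℓ ≤ r)
                       (bounded : i + ℓ ≤ length w) (spec : ∀ t → t < ℓ → SimpleCycle.letter C t ≡ w ! (i + t)) where
      open SimpleCycle C

      within : ∀ {t} → t < ℓ → i + t < length w
      within t<ℓ = <-≤-trans (+-monoʳ-< i t<ℓ) bounded

      first : 0 < ℓ → letter 0 ≡ w ! i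
      first ℓ>0 = trans (spec 0 ℓ>0) (cong (w !_) (+-identityʳ i))

      alternate₀₁ : 1 < ℓ → Alternate (letter 0) (letter 1)
      alternate₀₁ 1<ℓ = subst₂ Alternate (sym (first (<-trans z<s 1<ℓ))) (sym (spec 1 1<ℓ))
                                 (blocks-window₂ w-blocks i (within 1<ℓ))

      window₀₂ : 2 < ℓ → letter 2 ≡± letter 0
      window₀₂ 2<ℓ = subst₂ _≡±_ (sym (spec 2 2<ℓ)) (sym (first (<-trans z<s 2<ℓ)))
                              (blocks-window₃ w-blocks i (within 2<ℓ))

      window₀₃ : 3 < ℓ → letter 3 ≡± letter 1 × (letter 2 ≡ letter 0 ⁻¹ ⊎ letter 3 ≡ letter 1 ⁻¹)
      window₀₃ 3<ℓ with blocks-window₄ w-blocks i (within 3<ℓ)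
      ... | w₃≡±w₁ , turn = subst₂ _≡±_ (sym b₃) (sym b₁) w₃≡±w₁ , Data.Sum.map
            (λ w₂≡w₀⁻¹ → trans b₂ (trans w₂≡w₀⁻¹ (cong _⁻¹ (sym b₀))))
            (λ w₃≡w₁⁻¹ → trans b₃ (trans w₃≡w₁⁻¹ (cong _⁻¹ (sym b₁)))) turn
        where
        b₀ : letter 0 ≡ w ! i
        b₀ = first (<-trans z<s 3<ℓ)
        b₁ : letter 1 ≡ w ! (i + 1)
        b₁ = spec 1 (<-trans (s<s z<s) 3<ℓ)
        b₂ : letter 2 ≡ w ! (i + 2)
        b₂ = spec 2 (<-trans (s<s (s<s z<s)) 3<ℓ)
        b₃ : letter 3 ≡ w ! (i + 3)
        b₃ = spec 3 3<ℓ

      linked : 2 ≤ ℓ → ∀ m → letter (suc m) ~ letter m ⁻¹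
      linked 2≤ℓ = simpleCycle-linked v C 2≤ℓ ℓ≤r

    cycle-fullyLinked : ∀ {w} → Blocks w → ∀ {i ℓ} (C : SimpleCycle ℓ) → 0 < ℓ → ℓ ≤ r → i + ℓ ≤ length w →
                        (∀ t → t < ℓ → SimpleCycle.letter C t ≡ w ! (i + t)) → FullyLinked g h
    cycle-fullyLinked _ {ℓ = 1} C _ _ _ _ =
      ⊥-elim (∈S⇒≢ε (letter∈S 0) (trans (sym (identityˡ (letter 0))) period-product))
      where open SimpleCycle C
    cycle-fullyLinked w-blocks {ℓ = 2} C _ ℓ≤r bounded spec =
      ⊥-elim (alternate-≢± (alternate₀₁ (s<s z<s)) (inj₂ (inverseʳ-unique (letter 0) (letter 1) closes)))
      where
      open SimpleCycle C
      open CycleInWord _ w-blocks C ℓ≤r bounded spec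
      closes : letter 0 ∙ letter 1 ≡ ε
      closes = trans (cong (_∙ letter 1) (sym (identityˡ (letter 0)))) period-product
    cycle-fullyLinked w-blocks {ℓ = 3} C _ ℓ≤r bounded spec =
      alternate-fullyLinked (alternate₀₁ (s<s z<s))
        (triangle-fullyLinked closes (∈S⇒≢ε (letter∈S 1)) (window₀₂ (s<s (s<s z<s)))
          (linked 2≤3 0) (linked 2≤3 1) (subst (_~ letter 2 ⁻¹) (letter-periodic 0) (linked 2≤3 2)))
      where
      open SimpleCycle C
      open CycleInWord _ w-blocks C ℓ≤r bounded spec
      2≤3 : 2 ≤ 3
      2≤3 = s≤s (s≤s z≤n)
      closes : letter 0 ∙ letter 1 ∙ letter 2 ≡ ε
      closes = trans (cong (λ x → x ∙ letter 1 ∙ letter 2) (sym (identityˡ (letter 0)))) period-product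
    cycle-fullyLinked w-blocks {ℓ = suc (suc (suc (suc n)))} C _ ℓ≤r bounded spec =
      let b₃≡±b₁ , turn = window₀₃ (s<s (s<s (s<s z<s))) in
      alternate-fullyLinked (alternate₀₁ (s<s z<s))
        (square-fullyLinked (linked 2≤ℓ 0) (linked 2≤ℓ 1) (linked 2≤ℓ 2)
          (window₀₂ (s<s (s<s z<s))) b₃≡±b₁ turn)
      where
      open CycleInWord _ w-blocks C ℓ≤r bounded spec
      2≤ℓ : 2 ≤ 4 + n
      2≤ℓ = s≤s (s≤s z≤n)

    relator-fullyLinked : ∀ {k} → comm Γ (suc k) g h ≡ ε → 2 ^ (suc k + 1) ≤ r → FullyLinked g h
    relator-fullyLinked {k} relator short =
      cycle-fullyLinked (commWord-blocks k) periodicExtension period>0 ℓ≤r bounded periodicExtension-letter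
      where
      w : List V
      w = commWord k
      p : ℕ → V
      p t = product Γ (take t w)
      letter∈S : ∀ t → t < length w → w ! t ∈ S
      letter∈S t t<J = Data.Sum.[ ≡±-∈S g∈S , ≡±-∈S h∈S ] (blocks-letter (commWord-blocks k) t t<J)
      closes : p 0 ≡ p (length w)
      closes = sym (trans (cong (product Γ) (take-all (length w) w ≤-refl)) (trans (commWord-product k) relator))
      repetition : FirstRepetition p (length w)
      repetition = firstRepetition _≟ᶠ_ p z<s closes
      open FirstRepetition repetition renaming (start to i; period to ℓ)
      open PeriodicExtension letter∈S (λ t → product-take-suc w) repetition
      ℓ≤r : ℓ ≤ r
      ℓ≤r = ≤-trans (m≤n+m ℓ i) (≤-trans bounded (subst (_≤ r) (sym (commWord-length k)) short))

  nilpotent-allLinked : ∀ {n} → NilpotentClassAtMost Γ (suc n) → 2 ^ (suc n + 1) ≤ r →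
                        ∀ {g h} → g ∈ S → h ∈ S → ¬ g ≡± h → ∀ s t → s ∈ S → t ∈ S → Linked r v s t
  nilpotent-allLinked {n} nilpotent short g∈S h∈S g≢±h =
    fullyLinked⇒allLinked g∈S h∈S g≢±h
      λ x y x∈S y∈S x≢±y → relator-fullyLinked x∈S y∈S x≢±y {n} (nilpotent x y x≢±y) short

-- A single generator up to inversion

module OneGenerator (Γ : FinGroup) (S : Subset (N Γ)) (isGen : IsGeneratingSet Γ S)
                    {a : Fin (N Γ)} (a∈S : a ∈ S) (S⊆±a : ∀ s → s ∈ S → Defs._≡±_ Γ s a) where
  open FinGroupProperties Γ
  open Cayley Γ S
  open Graph (Cay Γ S)
  open IsGeneratingSet isGen
  open ≡-Reasoning

  m : ℕ
  m = proj₁ (finiteOrder a)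

  open IsOrder (proj₂ (finiteOrder a))

  product-power : ∀ ss → All (_∈ S) ss → Σ ℕ λ k → pow Γ a k ≡ product Γ ss
  product-power []       []           = 0 , refl
  product-power (s ∷ ss) (s∈S ∷ ss∈S) with product-power ss ss∈S | S⊆±a s s∈S
  ... | k , eq | inj₁ refl = suc k , cong (a ∙_) eq
  ... | k , eq | inj₂ refl = m ∸ 1 + k , trans (pow-+ a (m ∸ 1) k) (cong₂ _∙_ pow-pred eq)

  power-surjective : ∀ x → Σ ℕ λ k → k < m × pow Γ a k ≡ x
  power-surjective x with generates x
  ... | ss , ss∈S , eq with product-power ss ss∈S
  ...   | k , pow-k = k % m , m%n<n k m , trans (sym (pow-% k)) (trans pow-k eq)

  2≤m : 2 ≤ m
  2≤m with m | positive | pow-m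
  ... | 1 | _ | a≡ε = ⊥-elim (noIdentity (subst (_∈ S) (trans (sym (identityʳ a)) a≡ε) a∈S))
  ... | suc (suc _) | _ | _ = s≤s (s≤s z≤n)

  powerCycle : SimpleCycle m
  powerCycle = record
    { vertex   = pow Γ a
    ; letter   = λ _ → a
    ; letter∈S = λ _ → a∈S
    ; step     = pow-suc a
    ; periodic = pow-periodic
    ; simple   = pow-shift-≢
    }

  short-allLinked : ∀ {r v} → m ≤ r → ∀ s t → s ∈ S → t ∈ S → Linked r v s t
  short-allLinked {r} {v} m≤r s t s∈S t∈S = joined-sym (fromA (S⊆±a s s∈S)) ◅◅ fromA (S⊆±a t t∈S)
    where
    open LocalConnectivity (Cay Γ S) using (joined-sym)
    fromA : ∀ {s} → s ≡± a → Linked r v a s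
    fromA (inj₁ refl) = ε⋆
    fromA (inj₂ refl) = simpleCycle-linked v powerCycle 2≤m m≤r 0

  powers-surjective : ∀ x → Σ (Fin m) λ i → ∀ {j} → j ≡ i → pow Γ a (toℕ j) ≡ x
  powers-surjective x with power-surjective x
  ... | k , k<m , pow-k = fromℕ< k<m , λ { refl → trans (cong (pow Γ a) (toℕ-fromℕ< k<m)) pow-k }

  powers : Fin m ⤖ V
  powers = mk⤖ ((λ {i} {j} eq → toℕ-injective (pow-injective (toℕ<n i) (toℕ<n j) eq)) , powers-surjective)

  step⇒cycSucc : ∀ (i j : Fin m) → pow Γ a (toℕ j) ≡ pow Γ a (toℕ i) ∙ a → CycSucc m i j
  step⇒cycSucc i j eq with m≤n⇒m<n∨m≡n (toℕ<n i)
  ... | inj₁ i+1<m = inj₁ (pow-injective i+1<m (toℕ<n j) (trans (pow-suc a (toℕ i)) (sym eq)))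
  ... | inj₂ i+1≡m = inj₂ (i+1≡m , pow-injective (toℕ<n j) positive
                             (trans eq (trans (sym (pow-suc a (toℕ i))) (trans (cong (pow Γ a) i+1≡m) pow-m))))

  cycSucc⇒step : ∀ (i j : Fin m) → CycSucc m i j → pow Γ a (toℕ j) ≡ pow Γ a (toℕ i) ∙ a
  cycSucc⇒step i j (inj₁ i+1≡j)         = trans (cong (pow Γ a) (sym i+1≡j)) (pow-suc a (toℕ i))
  cycSucc⇒step i j (inj₂ (i+1≡m , j≡0)) = begin
    pow Γ a (toℕ j)           ≡⟨ cong (pow Γ a) j≡0 ⟩
    ε                         ≡⟨ pow-m ⟨
    pow Γ a m                 ≡⟨ cong (pow Γ a) i+1≡m ⟨
    pow Γ a (suc (toℕ i))     ≡⟨ pow-suc a (toℕ i) ⟩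
    pow Γ a (toℕ i) ∙ a       ∎

  powers-adjacent : ∀ i j → Cay Γ S (pow Γ a (toℕ i)) (pow Γ a (toℕ j)) ⇔ (CycSucc m i j ⊎ CycSucc m j i)
  powers-adjacent i j = mk⇔ to from
    where
    to : Cay Γ S (pow Γ a (toℕ i)) (pow Γ a (toℕ j)) → CycSucc m i j ⊎ CycSucc m j i
    to (s , s∈S , eq) with S⊆±a s s∈S
    ... | inj₁ refl = inj₁ (step⇒cycSucc i j eq)
    ... | inj₂ refl = inj₂ (step⇒cycSucc j i (trans (sym (//-rightDividesˡ a _)) (cong (_∙ a) (sym eq))))
    from : CycSucc m i j ⊎ CycSucc m j i → Cay Γ S (pow Γ a (toℕ i)) (pow Γ a (toℕ j))
    from (inj₁ succ) = a , a∈S , cycSucc⇒step i j succ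
    from (inj₂ succ) = a ⁻¹ , inverseClosed a a∈S , x≈z//y _ a _ (sym (cycSucc⇒step j i succ))

  localCutvertex⇒cycle : ∀ {r v} → 2 ≤ r → LocalCutvertex r v → Σ ℕ (λ m → r < m × IsCycleOfLength m) × Cyclic Γ
  localCutvertex⇒cycle {r} 2≤r cut = (m , r<m , ≤-trans (s≤s 2≤r) r<m , powers , powers-adjacent) ,
                             (a , λ x → proj₁ (power-surjective x) , proj₂ (proj₂ (power-surjective x)))
    where
    r<m : r < m
    r<m = ≰⇒> λ m≤r → allLinked⇒¬localCutvertex (short-allLinked m≤r) cut

theorem4p1 : (Γ : FinGroup) (S : Subset (N Γ)) → IsGeneratingSet Γ S →
    (n : ℕ) → 1 ≤ n → NilpotentClassAtMost Γ n →
    (r : ℕ) → 2 ^ (n + 1) ≤ r →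
    Σ (Fin (N Γ)) (λ v → Graph.LocalCutvertex (Cay Γ S) r v) →
    Σ ℕ (λ m → r < m × Graph.IsCycleOfLength (Cay Γ S) m) × Cyclic Γ
theorem4p1 Γ S isGen (suc k) _ nilpotent r 2^n+1≤r (v , cut)
  with a , a∈S ← Cayley.localCutvertex⇒generator Γ S cut
  with Cayley.generators-dichotomy Γ S a∈S
... | inj₁ (h , h∈S , a≢±h) = ⊥-elim (Cayley.allLinked⇒¬localCutvertex Γ S allLinked cut)
  where
  allLinked : ∀ s t → s ∈ S → t ∈ S → Cayley.Linked Γ S r v s t
  allLinked = TwoGenerators.nilpotent-allLinked Γ S isGen v {k} nilpotent 2^n+1≤r a∈S h∈S a≢±h
... | inj₂ S⊆±a = OneGenerator.localCutvertex⇒cycle Γ S isGen a∈S S⊆±a 2≤r cut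
  where
  2≤r : 2 ≤ r
  2≤r = ≤-trans (*-monoʳ-≤ 2 (m^n>0 2 (k + 1))) 2^n+1≤r
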